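{- For $n\ge 0$, let $v_n$ be the total number of pairs $(T,P)$, where $T$ is a tiling of the $(1\times n)$-board by $(1\times 1)$-squares and $(1\times 2)$-dominoes, and $P$ is a shortest lattice walk crossing the tiled board in the sense described in the context. Then $$v_n=2v_{n-1}+v_{n-2}-2v_{n-3}-v_{n-4}\qquad\text{for all } n\ge 4,$$ with $v_0=1$, $v_1=2$, $v_2=5$, $v_3=10$. Moreover, for all $n\ge 0$, $$5\,v_n=2(n+2)F_{n+1}+(n+1)F_{n+2},$$ where $(F_n)$ is the Fibonacci sequence with $F_0=0$, $F_1=1$ and $F_n=F_{n-1}+F_{n-2}$.
   Context: The $(1\times n)$-board is the rectangle $[0,n]\times[0,1]$ subdivided into $n$ unit cells; its grid segments are the unit edges of these cells. A tiling covers the board with non-overlapping unit squares and dominoes, a domino being the union of two horizontally adjacent cells. Given a tiling, a walk crossing the board is a path along grid segments from the lower-left corner $(0,0)$ to the upper-right corner $(n,1)$ of shortest possible length, i.e. of length $n+1$, consisting of unit right and up steps. The walk may not use any grid segment lying in the interior of a domino, i.e. the segment separating the two cells of a domino. For $n=0$ the board is the single segment from $(0,0)$ to $(0,1)$, there is one empty tiling, and exactly one walk. -}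

module Defs where

open import Data.Nat using (ℕ; zero; suc; _+_)
open import Data.Bool using (Bool; true; false)
open import Data.List using (List; []; _∷_; map)
open import Data.Nat.ListAction using (sum)
open import Data.List.Relation.Unary.All using (All)
open import Data.Vec using (Vec; toList)
open import Data.Product using (Σ; _×_)
open import Relation.Binary.PropositionalEquality using (_≡_)

data Tile : Set where
  sq dom : Tile

width : Tile → ℕ
width sq  = 1
width dom = 2

-- A tiling of the (1×n)-board: the tiles listed from left to right,
-- with total width n.
Tiling : ℕ → Set
Tiling n = Σ (List Tile) (λ ts → sum (map width ts) ≡ n)

-- interior ts x = true iff the vertical grid segment {x}×[0,1] lies in the
-- interior of a domino of the tiling ts (i.e. separates the two cells of a
-- domino). Horizontal grid segments are never interior to a domino.
interior : List Tile → ℕ → Bool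
interior []         _             = false
interior (sq ∷ ts)  zero          = false
interior (sq ∷ ts)  (suc k)       = interior ts k
interior (dom ∷ ts) zero          = false
interior (dom ∷ ts) (suc zero)    = true
interior (dom ∷ ts) (suc (suc k)) = interior ts k

data Step : Set where
  R U : Step

countU : List Step → ℕ
countU []      = 0
countU (R ∷ s) = countU s
countU (U ∷ s) = suc (countU s)

verticalXs : ℕ → List Step → List ℕ
verticalXs x []      = []
verticalXs x (R ∷ s) = verticalXs (suc x) s
verticalXs x (U ∷ s) = x ∷ verticalXs x s

-- A shortest walk from (0,0) to (n,1): n+1 unit right/up steps, exactly
-- one of which is up (hence n are right).
ShortestWalk : ℕ → Set
ShortestWalk n = Σ (Vec Step (suc n)) (λ w → countU (toList w) ≡ 1)

Avoids : List Tile → List Step → Set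
Avoids ts w = All (λ x → interior ts x ≡ false) (verticalXs 0 w)

TiledWalk : ℕ → Set
TiledWalk n = Σ (Tiling n) (λ T → Σ (ShortestWalk n) (λ P →
                 Avoids (Data.Product.proj₁ T) (toList (Data.Product.proj₁ P))))

fib : ℕ → ℕ
fib 0             = 0
fib 1             = 1
fib (suc (suc n)) = fib (suc n) + fib n

-- A tiled walk is determined by its first tile and by whether its single up
-- step is taken at x = 0: if so, the rest of the walk runs along the top edge
-- and only the remaining tiling is free; otherwise the walk crosses the whole
-- first tile along the bottom edge and what is left is a tiled walk of a
-- shorter board. With fib (1 + n) tilings of the (1×n)-board, the number
-- v n of tiled walks therefore satisfies
--   v (2 + n) = (fib (2 + n) + v (1 + n)) + (fib (1 + n) + v n),
-- from which the order-four recurrence and the closed form follow by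
-- induction and ring normalisation.
module Submission where

open import Defs
open import Data.Nat using (ℕ; zero; suc; _+_; _*_)
open import Data.Nat.Properties using (suc-injective; +-comm)
import Data.Nat.Properties as ℕ
open import Data.Nat.ListAction using (sum)
open import Data.Integer using (ℤ; +_; _-_)
import Data.Integer as ℤ
import Data.Integer.Properties as ℤ
open import Data.Bool using (false)
import Data.Bool as Bool
open import Data.List using (List; []; _∷_; map)
open import Data.List.Relation.Unary.All as All using (All; []; _∷_)
open import Data.List.Relation.Unary.All.Properties using (map⁻; map⁺)
open import Data.Vec using (Vec; []; _∷_; toList; replicate)
open import Data.Fin using (Fin)
open import Data.Fin.Properties using (+↔⊎)
open import Data.Product using (Σ; _×_; _,_; proj₁; proj₂)
open import Data.Sum using (_⊎_; inj₁; inj₂)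
open import Data.Sum.Function.Propositional using (_⊎-↔_)
open import Function using (_∘_)
open import Function.Bundles using (_↔_; mk↔ₛ′)
open import Function.Properties.Inverse using (↔-trans; ↔-sym)
open import Relation.Binary.PropositionalEquality using (_≡_; refl; sym; trans; cong; cong₂; subst; module ≡-Reasoning)
open import Axiom.UniquenessOfIdentityProofs using (module Decidable⇒UIP)
import Data.Nat.Tactic.RingSolver as ℕ-Solver
import Data.Integer.Tactic.RingSolver as ℤ-Solver

private
  variable
    n : ℕ

Tiling-≡ : {ts ts′ : List Tile} {p : sum (map width ts) ≡ n} {p′ : sum (map width ts′) ≡ n} →
           ts ≡ ts′ → _≡_ {A = Tiling n} (ts , p) (ts′ , p′)
Tiling-≡ {p = p} {p′} refl with ℕ.≡-irrelevant p p′
... | refl = refl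

Avoids-irrelevant : ∀ {ts w} (a a′ : Avoids ts w) → a ≡ a′
Avoids-irrelevant = All.irrelevant (Decidable⇒UIP.≡-irrelevant Bool._≟_)

TiledWalk-≡ : {ts ts′ : List Tile} {p : sum (map width ts) ≡ n} {p′ : sum (map width ts′) ≡ n}
              {w w′ : Vec Step (suc n)} {c : countU (toList w) ≡ 1} {c′ : countU (toList w′) ≡ 1}
              {a : Avoids ts (toList w)} {a′ : Avoids ts′ (toList w′)} →
              ts ≡ ts′ → w ≡ w′ →
              _≡_ {A = TiledWalk n} ((ts , p) , (w , c) , a) ((ts′ , p′) , (w′ , c′) , a′)
TiledWalk-≡ {ts = ts} {p = p} {p′} {w = w} {c = c} {c′} {a} {a′} refl refl
  with ℕ.≡-irrelevant p p′ | ℕ.≡-irrelevant c c′ | Avoids-irrelevant {ts} {toList w} a a′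
... | refl | refl | refl = refl

verticalXs-suc : ∀ x w → verticalXs (suc x) w ≡ map suc (verticalXs x w)
verticalXs-suc x []      = refl
verticalXs-suc x (R ∷ w) = verticalXs-suc (suc x) w
verticalXs-suc x (U ∷ w) = cong (suc x ∷_) (verticalXs-suc x w)

module _ (P : ℕ → Set) where

  All-verticalXs-suc⁺ : ∀ x w → All (P ∘ suc) (verticalXs x w) → All P (verticalXs (suc x) w)
  All-verticalXs-suc⁺ x w a = subst (All P) (sym (verticalXs-suc x w)) (map⁺ a)

  All-verticalXs-suc⁻ : ∀ x w → All P (verticalXs (suc x) w) → All (P ∘ suc) (verticalXs x w)
  All-verticalXs-suc⁻ x w a = map⁻ (subst (All P) (verticalXs-suc x w) a)

Free : List Tile → ℕ → Set
Free ts x = interior ts x ≡ false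

avoids-sq⁺ : ∀ {ts} w → Avoids ts w → Avoids (sq ∷ ts) (R ∷ w)
avoids-sq⁺ {ts} = All-verticalXs-suc⁺ (Free (sq ∷ ts)) 0

avoids-sq⁻ : ∀ {ts} w → Avoids (sq ∷ ts) (R ∷ w) → Avoids ts w
avoids-sq⁻ {ts} = All-verticalXs-suc⁻ (Free (sq ∷ ts)) 0

avoids-dom⁺ : ∀ {ts} w → Avoids ts w → Avoids (dom ∷ ts) (R ∷ R ∷ w)
avoids-dom⁺ {ts} w = All-verticalXs-suc⁺ (Free (dom ∷ ts)) 1 w ∘ All-verticalXs-suc⁺ (Free (dom ∷ ts) ∘ suc) 0 w

avoids-dom⁻ : ∀ {ts} w → Avoids (dom ∷ ts) (R ∷ R ∷ w) → Avoids ts w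
avoids-dom⁻ {ts} w = All-verticalXs-suc⁻ (Free (dom ∷ ts) ∘ suc) 0 w ∘ All-verticalXs-suc⁻ (Free (dom ∷ ts)) 1 w

countU-replicate-R : ∀ m → countU (toList (replicate m R)) ≡ 0
countU-replicate-R zero    = refl
countU-replicate-R (suc m) = countU-replicate-R m

verticalXs-replicate-R : ∀ x m → verticalXs x (toList (replicate m R)) ≡ []
verticalXs-replicate-R x zero    = refl
verticalXs-replicate-R x (suc m) = verticalXs-replicate-R (suc x) m

countU≡0⇒replicate-R : ∀ {m} (w : Vec Step m) → countU (toList w) ≡ 0 → w ≡ replicate m R
countU≡0⇒replicate-R []      _  = refl
countU≡0⇒replicate-R (R ∷ w) c  = cong (R ∷_) (countU≡0⇒replicate-R w c)
countU≡0⇒replicate-R (U ∷ w) ()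

avoids-U∷replicate-R : ∀ {ts} m → Free ts 0 → Avoids ts (U ∷ toList (replicate m R))
avoids-U∷replicate-R {ts} m free =
  free ∷ subst (All (Free ts)) (sym (verticalXs-replicate-R 0 m)) []

data Tiles : ℕ → Set where
  empty : Tiles 0
  sq∷_  : Tiles n → Tiles (suc n)
  dom∷_ : Tiles n → Tiles (suc (suc n))

consTiling : (tile : Tile) → Tiling n → Tiling (width tile + n)
consTiling tile (ts , p) = tile ∷ ts , cong (λ m → width tile + m) p

toTiling : Tiles n → Tiling n
toTiling empty    = [] , refl
toTiling (sq∷ t)  = consTiling sq (toTiling t)
toTiling (dom∷ t) = consTiling dom (toTiling t)

fromTiling : Tiling n → Tiles n
fromTiling {zero}        _              = empty
fromTiling {suc n}       ([] , ())
fromTiling {suc n}       (sq ∷ ts , p)  = sq∷ fromTiling (ts , suc-injective p)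
fromTiling {suc zero}    (dom ∷ ts , ())
fromTiling {suc (suc n)} (dom ∷ ts , p) = dom∷ fromTiling (ts , suc-injective (suc-injective p))

fromTiling∘toTiling : (t : Tiles n) → fromTiling (toTiling t) ≡ t
fromTiling∘toTiling empty    = refl
fromTiling∘toTiling (sq∷ t)  = cong sq∷_ (trans (cong fromTiling (Tiling-≡ refl)) (fromTiling∘toTiling t))
fromTiling∘toTiling (dom∷ t) = cong dom∷_ (trans (cong fromTiling (Tiling-≡ refl)) (fromTiling∘toTiling t))

toTiling∘fromTiling : (T : Tiling n) → toTiling (fromTiling T) ≡ T
toTiling∘fromTiling {zero}        ([] , _)        = Tiling-≡ refl
toTiling∘fromTiling {zero}        (sq ∷ ts , ())
toTiling∘fromTiling {zero}        (dom ∷ ts , ())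
toTiling∘fromTiling {suc n}       ([] , ())
toTiling∘fromTiling {suc n}       (sq ∷ ts , p)   =
  Tiling-≡ (cong (sq ∷_) (cong proj₁ (toTiling∘fromTiling (ts , suc-injective p))))
toTiling∘fromTiling {suc zero}    (dom ∷ ts , ())
toTiling∘fromTiling {suc (suc n)} (dom ∷ ts , p)  =
  Tiling-≡ (cong (dom ∷_) (cong proj₁ (toTiling∘fromTiling (ts , suc-injective (suc-injective p)))))

data Crossing : ℕ → Set where
  up    : Crossing 0
  sq↑_  : Tiles n → Crossing (suc n)
  sq→_  : Crossing n → Crossing (suc n)
  dom↑_ : Tiles n → Crossing (suc (suc n))
  dom→_ : Crossing n → Crossing (suc (suc n))

climbingWalk : (T : Tiling n) → Free (proj₁ T) 0 → TiledWalk n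
climbingWalk {n} T free =
  T , (U ∷ replicate n R , cong suc (countU-replicate-R n)) , avoids-U∷replicate-R {proj₁ T} n free

sq∷walk : TiledWalk n → TiledWalk (suc n)
sq∷walk (T , (w , c) , a) = consTiling sq T , (R ∷ w , c) , avoids-sq⁺ (toList w) a

dom∷walk : TiledWalk n → TiledWalk (suc (suc n))
dom∷walk (T , (w , c) , a) = consTiling dom T , (R ∷ R ∷ w , c) , avoids-dom⁺ (toList w) a

toTiledWalk : Crossing n → TiledWalk n
toTiledWalk up        = climbingWalk ([] , refl) refl
toTiledWalk (sq↑ t)   = climbingWalk (consTiling sq (toTiling t)) refl
toTiledWalk (sq→ x)   = sq∷walk (toTiledWalk x)
toTiledWalk (dom↑ t)  = climbingWalk (consTiling dom (toTiling t)) refl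
toTiledWalk (dom→ x)  = dom∷walk (toTiledWalk x)

fromTiledWalk : TiledWalk n → Crossing n
fromTiledWalk {zero}        _                                   = up
fromTiledWalk {suc n}       (([] , ()) , _)
fromTiledWalk {suc n}       ((sq ∷ ts , p) , (U ∷ w , c) , a)   = sq↑ fromTiling (ts , suc-injective p)
fromTiledWalk {suc n}       ((sq ∷ ts , p) , (R ∷ w , c) , a)   =
  sq→ fromTiledWalk ((ts , suc-injective p) , (w , c) , avoids-sq⁻ (toList w) a)
fromTiledWalk {suc zero}    ((dom ∷ ts , ()) , _)
fromTiledWalk {suc (suc n)} ((dom ∷ ts , p) , (U ∷ w , c) , a)  = dom↑ fromTiling (ts , suc-injective (suc-injective p))
-- an up step at x = 1 would cut the domino
fromTiledWalk {suc (suc n)} ((dom ∷ ts , p) , (R ∷ U ∷ w , c) , (() ∷ _))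
fromTiledWalk {suc (suc n)} ((dom ∷ ts , p) , (R ∷ R ∷ w , c) , a) =
  dom→ fromTiledWalk ((ts , suc-injective (suc-injective p)) , (w , c) , avoids-dom⁻ (toList w) a)

fromTiledWalk∘toTiledWalk : (x : Crossing n) → fromTiledWalk (toTiledWalk x) ≡ x
fromTiledWalk∘toTiledWalk up       = refl
fromTiledWalk∘toTiledWalk (sq↑ t)  = cong sq↑_ (trans (cong fromTiling (Tiling-≡ refl)) (fromTiling∘toTiling t))
fromTiledWalk∘toTiledWalk (sq→ x)  =
  cong sq→_ (trans (cong fromTiledWalk (TiledWalk-≡ refl refl)) (fromTiledWalk∘toTiledWalk x))
fromTiledWalk∘toTiledWalk (dom↑ t) = cong dom↑_ (trans (cong fromTiling (Tiling-≡ refl)) (fromTiling∘toTiling t))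
fromTiledWalk∘toTiledWalk (dom→ x) =
  cong dom→_ (trans (cong fromTiledWalk (TiledWalk-≡ refl refl)) (fromTiledWalk∘toTiledWalk x))

toTiledWalk∘fromTiledWalk : (x : TiledWalk n) → toTiledWalk (fromTiledWalk x) ≡ x
toTiledWalk∘fromTiledWalk {zero}        (([] , _) , (U ∷ [] , _) , _)        = TiledWalk-≡ refl refl
toTiledWalk∘fromTiledWalk {zero}        (([] , _) , (R ∷ [] , ()) , _)
toTiledWalk∘fromTiledWalk {zero}        ((sq ∷ ts , ()) , _)
toTiledWalk∘fromTiledWalk {zero}        ((dom ∷ ts , ()) , _)
toTiledWalk∘fromTiledWalk {suc n}       (([] , ()) , _)
toTiledWalk∘fromTiledWalk {suc n}       ((sq ∷ ts , p) , (U ∷ w , c) , a)    =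
  TiledWalk-≡ (cong (sq ∷_) (cong proj₁ (toTiling∘fromTiling (ts , suc-injective p))))
              (cong (U ∷_) (sym (countU≡0⇒replicate-R w (suc-injective c))))
toTiledWalk∘fromTiledWalk {suc n}       ((sq ∷ ts , p) , (R ∷ w , c) , a)    =
  TiledWalk-≡ (cong (λ x → sq ∷ proj₁ (proj₁ x)) ih) (cong (λ x → R ∷ proj₁ (proj₁ (proj₂ x))) ih)
  where ih = toTiledWalk∘fromTiledWalk ((ts , suc-injective p) , (w , c) , avoids-sq⁻ (toList w) a)
toTiledWalk∘fromTiledWalk {suc zero}    ((dom ∷ ts , ()) , _)
toTiledWalk∘fromTiledWalk {suc (suc n)} ((dom ∷ ts , p) , (U ∷ w , c) , a)   =
  TiledWalk-≡ (cong (dom ∷_) (cong proj₁ (toTiling∘fromTiling (ts , suc-injective (suc-injective p)))))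
              (cong (U ∷_) (sym (countU≡0⇒replicate-R w (suc-injective c))))
toTiledWalk∘fromTiledWalk {suc (suc n)} ((dom ∷ ts , p) , (R ∷ U ∷ w , c) , (() ∷ _))
toTiledWalk∘fromTiledWalk {suc (suc n)} ((dom ∷ ts , p) , (R ∷ R ∷ w , c) , a) =
  TiledWalk-≡ (cong (λ x → dom ∷ proj₁ (proj₁ x)) ih) (cong (λ x → R ∷ R ∷ proj₁ (proj₁ (proj₂ x))) ih)
  where ih = toTiledWalk∘fromTiledWalk ((ts , suc-injective (suc-injective p)) , (w , c) , avoids-dom⁻ (toList w) a)

TiledWalk↔Crossing : TiledWalk n ↔ Crossing n
TiledWalk↔Crossing = mk↔ₛ′ fromTiledWalk toTiledWalk fromTiledWalk∘toTiledWalk toTiledWalk∘fromTiledWalk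

singleton↔Fin1 : ∀ {A : Set} (a : A) → (∀ x → x ≡ a) → A ↔ Fin 1
singleton↔Fin1 a unique = mk↔ₛ′ (λ _ → Fin.zero) (λ _ → a) (λ { Fin.zero → refl ; (Fin.suc ()) }) (sym ∘ unique)

Tiles-suc-suc↔⊎ : Tiles (suc (suc n)) ↔ (Tiles (suc n) ⊎ Tiles n)
Tiles-suc-suc↔⊎ {n} = mk↔ₛ′ split join split∘join join∘split
  where
  split : Tiles (suc (suc n)) → Tiles (suc n) ⊎ Tiles n
  split (sq∷ t)  = inj₁ t
  split (dom∷ t) = inj₂ t
  join : Tiles (suc n) ⊎ Tiles n → Tiles (suc (suc n))
  join (inj₁ t) = sq∷ t
  join (inj₂ t) = dom∷ t
  split∘join : ∀ y → split (join y) ≡ y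
  split∘join (inj₁ t) = refl
  split∘join (inj₂ t) = refl
  join∘split : ∀ x → join (split x) ≡ x
  join∘split (sq∷ t)  = refl
  join∘split (dom∷ t) = refl

Tiles↔Fin : ∀ n → Tiles n ↔ Fin (fib (suc n))
Tiles↔Fin zero          = singleton↔Fin1 empty λ { empty → refl }
Tiles↔Fin (suc zero)    = singleton↔Fin1 (sq∷ empty) λ { (sq∷ empty) → refl }
Tiles↔Fin (suc (suc n)) =
  ↔-trans Tiles-suc-suc↔⊎ (↔-trans (Tiles↔Fin (suc n) ⊎-↔ Tiles↔Fin n) (↔-sym (+↔⊎ {fib (2 + n)})))

tiledWalkCount : ℕ → ℕ
tiledWalkCount 0             = 1
tiledWalkCount 1             = 2
tiledWalkCount (suc (suc n)) = (fib (2 + n) + tiledWalkCount (suc n)) + (fib (1 + n) + tiledWalkCount n)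

Crossing-suc-suc↔⊎ : Crossing (suc (suc n)) ↔ ((Tiles (suc n) ⊎ Crossing (suc n)) ⊎ (Tiles n ⊎ Crossing n))
Crossing-suc-suc↔⊎ {n} = mk↔ₛ′ split join split∘join join∘split
  where
  split : Crossing (suc (suc n)) → (Tiles (suc n) ⊎ Crossing (suc n)) ⊎ (Tiles n ⊎ Crossing n)
  split (sq↑ t)  = inj₁ (inj₁ t)
  split (sq→ x)  = inj₁ (inj₂ x)
  split (dom↑ t) = inj₂ (inj₁ t)
  split (dom→ x) = inj₂ (inj₂ x)
  join : (Tiles (suc n) ⊎ Crossing (suc n)) ⊎ (Tiles n ⊎ Crossing n) → Crossing (suc (suc n))
  join (inj₁ (inj₁ t)) = sq↑ t
  join (inj₁ (inj₂ x)) = sq→ x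
  join (inj₂ (inj₁ t)) = dom↑ t
  join (inj₂ (inj₂ x)) = dom→ x
  split∘join : ∀ y → split (join y) ≡ y
  split∘join (inj₁ (inj₁ t)) = refl
  split∘join (inj₁ (inj₂ x)) = refl
  split∘join (inj₂ (inj₁ t)) = refl
  split∘join (inj₂ (inj₂ x)) = refl
  join∘split : ∀ x → join (split x) ≡ x
  join∘split (sq↑ t)  = refl
  join∘split (sq→ x)  = refl
  join∘split (dom↑ t) = refl
  join∘split (dom→ x) = refl

Crossing↔Fin : ∀ n → Crossing n ↔ Fin (tiledWalkCount n)
Crossing↔Fin zero          = singleton↔Fin1 up λ { up → refl }
Crossing↔Fin (suc zero)    = mk↔ₛ′ to from to∘from from∘to
  where
  to : Crossing 1 → Fin 2
  to (sq↑ empty) = Fin.zero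
  to (sq→ up)    = Fin.suc Fin.zero
  from : Fin 2 → Crossing 1
  from Fin.zero           = sq↑ empty
  from (Fin.suc Fin.zero) = sq→ up
  to∘from : ∀ i → to (from i) ≡ i
  to∘from Fin.zero           = refl
  to∘from (Fin.suc Fin.zero) = refl
  from∘to : ∀ x → from (to x) ≡ x
  from∘to (sq↑ empty) = refl
  from∘to (sq→ up)    = refl
Crossing↔Fin (suc (suc n)) =
  ↔-trans Crossing-suc-suc↔⊎
    (↔-trans ((Tiles↔Fin (suc n) ⊎-↔ Crossing↔Fin (suc n)) ⊎-↔ (Tiles↔Fin n ⊎-↔ Crossing↔Fin n))
             (↔-sym (↔-trans (+↔⊎ {fib (2 + n) + tiledWalkCount (1 + n)})
                             (+↔⊎ {fib (2 + n)} ⊎-↔ +↔⊎ {fib (1 + n)}))))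

tiledWalkCount-recurrence : ∀ n →
  tiledWalkCount (4 + n) + 2 * tiledWalkCount (1 + n) + tiledWalkCount n ≡
  2 * tiledWalkCount (3 + n) + tiledWalkCount (2 + n)
tiledWalkCount-recurrence n = unfolded (fib (1 + n)) (fib n) (tiledWalkCount (1 + n)) (tiledWalkCount n)
  where
  unfolded : ∀ f₁ f₀ v₁ v₀ →
    let f₂ = f₁ + f₀ ; f₃ = f₂ + f₁ ; f₄ = f₃ + f₂
        v₂ = (f₂ + v₁) + (f₁ + v₀) ; v₃ = (f₃ + v₂) + (f₂ + v₁) ; v₄ = (f₄ + v₃) + (f₃ + v₂)
    in v₄ + 2 * v₁ + v₀ ≡ 2 * v₃ + v₂
  unfolded = ℕ-Solver.solve-∀

+≡+⇒ℤ-difference : ∀ a b c d e → a + d + e ≡ b + c → + a ≡ ((+ b ℤ.+ + c) - + d) - + e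
+≡+⇒ℤ-difference a b c d e eq = begin
  + a                                           ≡⟨ cancel (+ a) (+ d) (+ e) ⟩
  ((+ a ℤ.+ + d ℤ.+ + e) - + d) - + e           ≡⟨ cong (λ z → (z - + d) - + e) (sym (pos-+-+ a d e)) ⟩
  (+ (a + d + e) - + d) - + e                   ≡⟨ cong (λ m → (+ m - + d) - + e) eq ⟩
  (+ (b + c) - + d) - + e                       ≡⟨ cong (λ z → (z - + d) - + e) (ℤ.pos-+ b c) ⟩
  ((+ b ℤ.+ + c) - + d) - + e                   ∎
  where
  open ≡-Reasoning
  cancel : ∀ (A D E : ℤ) → A ≡ ((A ℤ.+ D ℤ.+ E) - D) - E
  cancel = ℤ-Solver.solve-∀
  pos-+-+ : ∀ a d e → + (a + d + e) ≡ + a ℤ.+ + d ℤ.+ + e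
  pos-+-+ a d e = trans (ℤ.pos-+ (a + d) e) (cong (ℤ._+ + e) (ℤ.pos-+ a d))

tiledWalkCount-closedForm : ∀ n →
  5 * tiledWalkCount n ≡ 2 * (2 + n) * fib (1 + n) + (1 + n) * fib (2 + n)
tiledWalkCount-closedForm zero          = refl
tiledWalkCount-closedForm (suc zero)    = refl
tiledWalkCount-closedForm (suc (suc n)) = begin
  5 * ((f₂ + v₁) + (f₁ + v₀))                          ≡⟨ distrib f₁ f₀ v₁ v₀ ⟩
  (5 * f₂ + 5 * f₁) + (5 * v₁ + 5 * v₀)                ≡⟨ cong₂ (λ x y → (5 * f₂ + 5 * f₁) + (x + y))
                                                                 (tiledWalkCount-closedForm (suc n))
                                                                 (tiledWalkCount-closedForm n) ⟩
  (5 * f₂ + 5 * f₁) + ((2 * (3 + n) * f₂ + (2 + n) * (f₂ + f₁)) + (2 * (2 + n) * f₁ + (1 + n) * f₂))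
                                                       ≡⟨ collect n f₁ f₀ ⟩
  2 * (4 + n) * (f₂ + f₁) + (3 + n) * ((f₂ + f₁) + f₂) ∎
  where
  open ≡-Reasoning
  f₀ = fib n ; f₁ = fib (1 + n) ; f₂ = fib (2 + n)
  v₀ = tiledWalkCount n ; v₁ = tiledWalkCount (1 + n)
  distrib : ∀ f₁ f₀ v₁ v₀ → 5 * (((f₁ + f₀) + v₁) + (f₁ + v₀)) ≡ (5 * (f₁ + f₀) + 5 * f₁) + (5 * v₁ + 5 * v₀)
  distrib = ℕ-Solver.solve-∀
  collect : ∀ n f₁ f₀ →
    let f₂ = f₁ + f₀ in
    (5 * f₂ + 5 * f₁) + ((2 * (3 + n) * f₂ + (2 + n) * (f₂ + f₁)) + (2 * (2 + n) * f₁ + (1 + n) * f₂))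
    ≡ 2 * (4 + n) * (f₂ + f₁) + (3 + n) * ((f₂ + f₁) + f₂)
  collect = ℕ-Solver.solve-∀

corollary1 : Σ (ℕ → ℕ) (λ v →
               (∀ n → TiledWalk n ↔ Fin (v n))
               × (∀ n → + v (4 + n) ≡ ((((+ (2 * v (3 + n))) Data.Integer.+ + v (2 + n)) - + (2 * v (1 + n))) - + v n))
               × v 0 ≡ 1 × v 1 ≡ 2 × v 2 ≡ 5 × v 3 ≡ 10
               × (∀ n → 5 * v n ≡ 2 * (n + 2) * fib (n + 1) + (n + 1) * fib (n + 2)))
corollary1 = tiledWalkCount , counts , recurrence , refl , refl , refl , refl , closedForm
  where
  v = tiledWalkCount
  counts : ∀ n → TiledWalk n ↔ Fin (v n)
  counts n = ↔-trans TiledWalk↔Crossing (Crossing↔Fin n)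
  recurrence : ∀ n → + v (4 + n) ≡ ((+ (2 * v (3 + n)) ℤ.+ + v (2 + n)) - + (2 * v (1 + n))) - + v n
  recurrence n =
    +≡+⇒ℤ-difference (v (4 + n)) (2 * v (3 + n)) (v (2 + n)) (2 * v (1 + n)) (v n) (tiledWalkCount-recurrence n)
  closedForm : ∀ n → 5 * v n ≡ 2 * (n + 2) * fib (n + 1) + (n + 1) * fib (n + 2)
  closedForm n rewrite +-comm n 1 | +-comm n 2 = tiledWalkCount-closedForm n
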